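{- Every palindromic factor of $\mathbf{y}=g(f^\omega(0))$ has a unique palindromic extension in $\mathbf{y}$, i.e., for every palindromic factor $w$ of $\mathbf{y}$ there is exactly one letter $a$ such that $awa$ is a factor of $\mathbf{y}$.
   Context: $f(0)=01$, $f(1)=022$, $f(2)=02$; $g(0)=20$, $g(1)=21$, $g(2)=2$ on $\Sigma_3=\{0,1,2\}$; $f^\omega(0)$ is the fixed point of $f$ beginning with $0$. -}

module Defs where

open import Data.Nat using (ℕ; zero; suc)
open import Data.List using (List; []; _∷_; _++_; concatMap; reverse; length)
open import Relation.Binary.PropositionalEquality using (_≡_)
open import Data.Product using (∃)

data Σ₃ : Set where
  𝟎 𝟏 𝟐 : Σ₃

f : Σ₃ → List Σ₃
f 𝟎 = 𝟎 ∷ 𝟏 ∷ []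
f 𝟏 = 𝟎 ∷ 𝟐 ∷ 𝟐 ∷ []
f 𝟐 = 𝟎 ∷ 𝟐 ∷ []

g : Σ₃ → List Σ₃
g 𝟎 = 𝟐 ∷ 𝟎 ∷ []
g 𝟏 = 𝟐 ∷ 𝟏 ∷ []
g 𝟐 = 𝟐 ∷ []

morph : (Σ₃ → List Σ₃) → List Σ₃ → List Σ₃
morph h = concatMap h

fIter : ℕ → List Σ₃
fIter zero    = 𝟎 ∷ []
fIter (suc n) = morph f (fIter n)

-- total list indexing with a default (only used at in-range indices)
at : List Σ₃ → ℕ → Σ₃
at []       _       = 𝟎
at (x ∷ xs) zero    = x
at (x ∷ xs) (suc i) = at xs i

Word : Set
Word = ℕ → Σ₃

-- f^ω(0): since f(0) begins with 0, f^n(0) is a prefix of f^{n+1}(0), and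
-- |f^n(0)| ≥ n+1, so position i of f^ω(0) is position i of f^{i}(0).
fω : Word
fω i = at (fIter i) i

-- y = g(f^ω(0)): g(f^n(0)) is a prefix of y and |g(f^n(0))| ≥ n+1,
-- so position i of y is position i of g(f^i(0)).
y : Word
y i = at (morph g (fIter i)) i

slice : Word → ℕ → ℕ → List Σ₃
slice u i zero    = []
slice u i (suc n) = u i ∷ slice u (suc i) n

Factor : List Σ₃ → Word → Set
Factor w u = ∃ λ i → slice u i (length w) ≡ w

Palindrome : List Σ₃ → Set
Palindrome w = reverse w ≡ w

-- With h = (0 ↦ 1, 1 ↦ 2, 2 ↦ 202) one has g ∘ f = h ∘ g, so y = g(f^ω(0)) is the fixed
-- point h^ω(2), and its factors are the factors of the palindromes h^n(2).  Since 0 occurs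
-- in images only inside 202, a factor that is not cut through such a block desubstitutes:
-- it is h(V) for a factor V of y, and its bordering letters are the first/last letters of
-- the images of the letters bordering V.
--
-- By induction on a weight that h increases, every palindromic factor W satisfies three
-- properties at once: W has a palindromic extension aWa, it is unique, and if 0W0 is a
-- factor then W never sits between two nonzero letters.  The third property is needed
-- because h sends both 1 and 2 to words bordered by 2, so uniqueness alone does not
-- transfer from V to h(V).  A palindrome starting with 0 or 1 is forced to extend by 2; a
-- palindrome 2 0 … 0 2 is h(V) for a lighter palindrome V; and for 2M2 with M not starting
-- with 0 one has M = h(V), where the extensions of 2M2 by 0, 1 and 2 come from the factors
-- 2V2, 0(1V1)0 and z(1V1)z' with z, z' nonzero.

module Submission where

open import Data.Empty using (⊥; ⊥-elim)
open import Data.List using (List; []; _∷_; _++_; _∷ʳ_; reverse; length; take; drop; head; last; concatMap; initLast; _∷ʳ′_)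
open import Data.List.Properties
  using (++-assoc; ++-identityʳ; ++-conicalˡ; ++-conicalʳ; ∷-injective; ∷-injectiveˡ; ∷-injectiveʳ; ∷ʳ-injectiveˡ; ++-cancelˡ; concatMap-++; reverse-++; unfold-reverse; reverse-involutive; length-take; length-drop; take++drop≡id; length-++-≤ˡ)
open import Data.Maybe using (Maybe; just; nothing)
open import Data.Nat using (ℕ; zero; suc; _+_; _∸_; _≤_; _<_; z≤n; s≤s)
open import Data.Nat.Properties
  using (≤-trans; <⇒≤; m≤n⇒m≤1+n; m≤n⇒m⊓n≡m; m+n≤o⇒m≤o; ∸-monoˡ-≤; m+n∸m≡n; +-comm; +-assoc; +-identityʳ; +-mono-≤; +-mono-<-≤; m≤m+n)
open import Data.Nat.Induction using (<-wellFounded)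
open import Data.Product using (∃; ∃₂; ∃!; _×_; _,_)
open import Data.Unit using (⊤; tt)
open import Induction.WellFounded using (WellFounded; module All)
open import Relation.Binary.Construct.On as On using ()
open import Relation.Nullary using (¬_)
open import Relation.Binary.PropositionalEquality
open ≡-Reasoning

open import Defs

h : Σ₃ → List Σ₃
h 𝟎 = 𝟏 ∷ []
h 𝟏 = 𝟐 ∷ []
h 𝟐 = 𝟐 ∷ 𝟎 ∷ 𝟐 ∷ []

ĥ : List Σ₃ → List Σ₃
ĥ = morph h

hIter : ℕ → List Σ₃
hIter zero    = 𝟐 ∷ []
hIter (suc n) = ĥ (hIter n)

ĥ-++ : ∀ X Y → ĥ (X ++ Y) ≡ ĥ X ++ ĥ Y
ĥ-++ = concatMap-++ h

ĥ-++₃ : ∀ A w B → ĥ (A ++ w ++ B) ≡ ĥ A ++ ĥ w ++ ĥ B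
ĥ-++₃ A w B = trans (ĥ-++ A (w ++ B)) (cong (ĥ A ++_) (ĥ-++ w B))

ĥ-bracket : ∀ a V a′ → ĥ (a ∷ V ∷ʳ a′) ≡ h a ++ ĥ V ++ h a′
ĥ-bracket a V a′ = cong (h a ++_) (trans (ĥ-++ V (a′ ∷ [])) (cong (ĥ V ++_) (++-identityʳ (h a′))))

ĥ-[] : ∀ {X} → ĥ X ≡ [] → X ≡ []
ĥ-[] {[]}    _  = refl
ĥ-[] {𝟎 ∷ _} ()
ĥ-[] {𝟏 ∷ _} ()
ĥ-[] {𝟐 ∷ _} ()

concatMap-reverse : ∀ {A B : Set} (σ : A → List B) → (∀ a → reverse (σ a) ≡ σ a) →
                    ∀ X → concatMap σ (reverse X) ≡ reverse (concatMap σ X)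
concatMap-reverse σ σ-pal []      = refl
concatMap-reverse σ σ-pal (x ∷ X) = begin
  concatMap σ (reverse (x ∷ X))             ≡⟨ cong (concatMap σ) (unfold-reverse x X) ⟩
  concatMap σ (reverse X ∷ʳ x)              ≡⟨ concatMap-++ σ (reverse X) (x ∷ []) ⟩
  concatMap σ (reverse X) ++ σ x ++ []      ≡⟨ cong₂ _++_ (concatMap-reverse σ σ-pal X) (trans (++-identityʳ (σ x)) (sym (σ-pal x))) ⟩
  reverse (concatMap σ X) ++ reverse (σ x)  ≡⟨ reverse-++ (σ x) (concatMap σ X) ⟨
  reverse (σ x ++ concatMap σ X)            ∎

ĥ-reverse : ∀ X → ĥ (reverse X) ≡ reverse (ĥ X)
ĥ-reverse = concatMap-reverse h λ { 𝟎 → refl ; 𝟏 → refl ; 𝟐 → refl }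

hIter-palindrome : ∀ n → Palindrome (hIter n)
hIter-palindrome zero    = refl
hIter-palindrome (suc n) = trans (sym (ĥ-reverse (hIter n))) (cong ĥ (hIter-palindrome n))

g∘f≡h∘g : ∀ X → morph g (morph f X) ≡ ĥ (morph g X)
g∘f≡h∘g []      = refl
g∘f≡h∘g (x ∷ X) = begin
  morph g (f x ++ morph f X)            ≡⟨ concatMap-++ g (f x) (morph f X) ⟩
  morph g (f x) ++ morph g (morph f X)  ≡⟨ cong₂ _++_ (on-letters x) (g∘f≡h∘g X) ⟩
  ĥ (g x) ++ ĥ (morph g X)              ≡⟨ ĥ-++ (g x) (morph g X) ⟨
  ĥ (g x ++ morph g X)                  ∎
  where
  on-letters : ∀ x → morph g (f x) ≡ ĥ (g x)
  on-letters 𝟎 = refl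
  on-letters 𝟏 = refl
  on-letters 𝟐 = refl

infix 4 _≼_
_≼_ : List Σ₃ → List Σ₃ → Set
A ≼ B = ∃ λ T → B ≡ A ++ T

≼-trans : ∀ {A B C} → A ≼ B → B ≼ C → A ≼ C
≼-trans {A} (T , refl) (U , refl) = T ++ U , ++-assoc A T U

≼-ĥ : ∀ {A B} → A ≼ B → ĥ A ≼ ĥ B
≼-ĥ {A} (T , refl) = ĥ T , ĥ-++ A T

≼-length : ∀ {A B} → A ≼ B → length A ≤ length B
≼-length {A} (T , refl) = length-++-≤ˡ A

at-≼ : ∀ {A B} → A ≼ B → ∀ {i} → i < length A → at B i ≡ at A i
at-≼ {a ∷ A} (T , refl) {zero}  _         = refl
at-≼ {a ∷ A} (T , refl) {suc i} (s≤s i<) = at-≼ {A} (T , refl) i<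

hIter-≼-suc : ∀ n → hIter n ≼ hIter (suc n)
hIter-≼-suc zero    = 𝟎 ∷ 𝟐 ∷ [] , refl
hIter-≼-suc (suc n) = ≼-ĥ (hIter-≼-suc n)

hIter-≼ : ∀ m k → hIter m ≼ hIter (k + m)
hIter-≼ m zero    = [] , sym (++-identityʳ (hIter m))
hIter-≼ m (suc k) = ≼-trans (hIter-≼ m k) (hIter-≼-suc (k + m))

-- g(f^n(0)) = h^n(g(0)) = h^n(20) lies between h^n(2) and h^(n+1)(2) = h^n(202)
hIter-≼-gfIter : ∀ n → hIter n ≼ morph g (fIter n)
hIter-≼-gfIter zero    = 𝟎 ∷ [] , refl
hIter-≼-gfIter (suc n) = subst (hIter (suc n) ≼_) (sym (g∘f≡h∘g (fIter n))) (≼-ĥ (hIter-≼-gfIter n))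

gfIter-≼-hIter : ∀ n → morph g (fIter n) ≼ hIter (suc n)
gfIter-≼-hIter zero    = 𝟐 ∷ [] , refl
gfIter-≼-hIter (suc n) = subst (_≼ hIter (suc (suc n))) (sym (g∘f≡h∘g (fIter n))) (≼-ĥ (gfIter-≼-hIter n))

length-ĥ : ∀ X → length X ≤ length (ĥ X)
length-ĥ []      = z≤n
length-ĥ (𝟎 ∷ X) = s≤s (length-ĥ X)
length-ĥ (𝟏 ∷ X) = s≤s (length-ĥ X)
length-ĥ (𝟐 ∷ X) = s≤s (m≤n⇒m≤1+n (m≤n⇒m≤1+n (length-ĥ X)))

hIter-starts-with-𝟐 : ∀ n → ∃ λ T → hIter n ≡ 𝟐 ∷ T
hIter-starts-with-𝟐 zero    = [] , refl
hIter-starts-with-𝟐 (suc n) with hIter-starts-with-𝟐 n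
... | T , eq = 𝟎 ∷ 𝟐 ∷ ĥ T , cong ĥ eq

length-hIter : ∀ n → n < length (hIter n)
length-hIter zero    = s≤s z≤n
length-hIter (suc n) with hIter-starts-with-𝟐 n
... | T , eq = ≤-trans (s≤s (length-hIter n))
                 (subst (λ X → length X < length (ĥ X)) (sym eq) (s≤s (s≤s (m≤n⇒m≤1+n (length-ĥ T)))))

Agrees : Word → List Σ₃ → Set
Agrees u X = ∀ {j} → j < length X → u j ≡ at X j

y-agrees-with-hIter : ∀ n → Agrees y (hIter n)
y-agrees-with-hIter n {i} i<n = begin
  at (morph g (fIter i)) i  ≡⟨ at-≼ (gfIter-≼-hIter i) i<gf ⟨
  at (hIter (suc i)) i      ≡⟨ at-≼ (hIter-≼ (suc i) n) (≤-trans (length-hIter i) (≼-length (hIter-≼-suc i))) ⟨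
  at (hIter (n + suc i)) i  ≡⟨ cong (λ m → at (hIter m) i) (+-comm n (suc i)) ⟩
  at (hIter (suc i + n)) i  ≡⟨ at-≼ (hIter-≼ n (suc i)) i<n ⟩
  at (hIter n) i            ∎
  where
  i<gf : i < length (morph g (fIter i))
  i<gf = ≤-trans (length-hIter i) (≼-length (hIter-≼-gfIter i))

-- Factors of y

slice-suc : ∀ u i n → slice u (suc i) n ≡ slice (λ j → u (suc j)) i n
slice-suc u i zero    = refl
slice-suc u i (suc n) = cong (u (suc i) ∷_) (slice-suc u (suc i) n)

Agrees-∷ : ∀ {u x X} → Agrees u (x ∷ X) → Agrees (λ j → u (suc j)) X
Agrees-∷ agr j< = agr (s≤s j<)

slice-prefix : ∀ {u} w {B} → Agrees u (w ++ B) → slice u 0 (length w) ≡ w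
slice-prefix     []      _   = refl
slice-prefix {u} (c ∷ w) agr = cong₂ _∷_ (agr (s≤s z≤n)) (trans (slice-suc u 0 (length w)) (slice-prefix w (Agrees-∷ agr)))

slice-infix : ∀ {u} A w {B} → Agrees u (A ++ w ++ B) → slice u (length A) (length w) ≡ w
slice-infix     []      w agr = slice-prefix w agr
slice-infix {u} (a ∷ A) w agr = trans (slice-suc u (length A) (length w)) (slice-infix A w (Agrees-∷ agr))

infix 4 _⊑_
_⊑_ : List Σ₃ → List Σ₃ → Set
w ⊑ X = ∃₂ λ A B → X ≡ A ++ w ++ B

IsFactor : List Σ₃ → Set
IsFactor w = ∃ λ n → w ⊑ hIter n

IsFactor⇒Factor : ∀ {w} → IsFactor w → Factor w y
IsFactor⇒Factor {w} (n , A , B , eq) = length A , slice-infix A w (subst (Agrees y) eq (y-agrees-with-hIter n))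

Factor⇒IsFactor : ∀ {w} → Factor w y → IsFactor w
Factor⇒IsFactor {w} (i , eq) = i + k , take i X , rest , trans decomposition (cong (λ v → take i X ++ v ++ rest) middle)
  where
  k = length w
  X = hIter (i + k)
  rest = drop k (drop i X)

  i+k≤ : i + k ≤ length X
  i+k≤ = <⇒≤ (length-hIter (i + k))

  decomposition : X ≡ take i X ++ take k (drop i X) ++ rest
  decomposition = sym (trans (cong (take i X ++_) (take++drop≡id k (drop i X))) (take++drop≡id i X))

  length-left : length (take i X) ≡ i
  length-left = trans (length-take i X) (m≤n⇒m⊓n≡m (m+n≤o⇒m≤o i i+k≤))

  length-middle : length (take k (drop i X)) ≡ k
  length-middle = trans (length-take k (drop i X)) (m≤n⇒m⊓n≡m k≤)
    where
    k≤ : k ≤ length (drop i X)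
    k≤ = subst (k ≤_) (sym (length-drop i X)) (subst (_≤ length X ∸ i) (m+n∸m≡n i k) (∸-monoˡ-≤ i i+k≤))

  middle : take k (drop i X) ≡ w
  middle = begin
    take k (drop i X)                                     ≡⟨ slice-infix (take i X) _ (subst (Agrees y) decomposition (y-agrees-with-hIter (i + k))) ⟨
    slice y (length (take i X)) (length (take k (drop i X))) ≡⟨ cong₂ (slice y) length-left length-middle ⟩
    slice y i k                                           ≡⟨ eq ⟩
    w                                                     ∎

⊑-refl : ∀ X → X ⊑ X
⊑-refl X = [] , [] , sym (++-identityʳ X)

⊑-inner : ∀ P w Q → w ⊑ P ++ w ++ Q
⊑-inner P w Q = P , Q , refl

⊑-trans : ∀ {u v X} → u ⊑ v → v ⊑ X → u ⊑ X
⊑-trans {u} (A , B , refl) (C , D , refl) = C ++ A , B ++ D , (begin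
  C ++ (A ++ u ++ B) ++ D    ≡⟨ cong (C ++_) (trans (++-assoc A (u ++ B) D) (cong (A ++_) (++-assoc u B D))) ⟩
  C ++ A ++ u ++ B ++ D      ≡⟨ ++-assoc C A (u ++ B ++ D) ⟨
  (C ++ A) ++ u ++ B ++ D    ∎)

≼⇒⊑ : ∀ {A B} → A ≼ B → A ⊑ B
≼⇒⊑ (T , eq) = [] , T , eq

⊑-ĥ : ∀ {w X} → w ⊑ X → ĥ w ⊑ ĥ X
⊑-ĥ {w} (A , B , refl) = ĥ A , ĥ B , ĥ-++₃ A w B

⊑-reverse : ∀ {w X} → w ⊑ X → reverse w ⊑ reverse X
⊑-reverse {w} (A , B , refl) = reverse B , reverse A , (begin
  reverse (A ++ w ++ B)                    ≡⟨ reverse-++ A (w ++ B) ⟩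
  reverse (w ++ B) ++ reverse A            ≡⟨ cong (_++ reverse A) (reverse-++ w B) ⟩
  (reverse B ++ reverse w) ++ reverse A    ≡⟨ ++-assoc (reverse B) (reverse w) (reverse A) ⟩
  reverse B ++ reverse w ++ reverse A      ∎)

bracket-assoc : ∀ (A : List Σ₃) x W x′ B → (A ∷ʳ x) ++ W ++ (x′ ∷ B) ≡ A ++ (x ∷ W ∷ʳ x′) ++ B
bracket-assoc []      x W x′ B = cong (x ∷_) (sym (++-assoc W (x′ ∷ []) B))
bracket-assoc (a ∷ A) x W x′ B = cong (a ∷_) (bracket-assoc A x W x′ B)

bracket-⊑ : ∀ {X} A {x W x′} B → X ≡ (A ∷ʳ x) ++ W ++ (x′ ∷ B) → x ∷ W ∷ʳ x′ ⊑ X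
bracket-⊑ A {x} {W} {x′} B eq = A , B , trans eq (bracket-assoc A x W x′ B)

infix 4 _⋐_
_⋐_ : List Σ₃ → List Σ₃ → Set
X ⋐ Y = ∃₂ λ L R → Y ≡ L ++ X ++ R × L ≢ [] × R ≢ []

⋐-ĥ : ∀ {X Y} → X ⋐ Y → ĥ X ⋐ ĥ Y
⋐-ĥ {X} (L , R , refl , L≢[] , R≢[]) = ĥ L , ĥ R , ĥ-++₃ L X R , (λ e → L≢[] (ĥ-[] e)) , (λ e → R≢[] (ĥ-[] e))

hIter-⋐ : ∀ n → hIter n ⋐ hIter (suc (suc n))
hIter-⋐ zero    = 𝟐 ∷ 𝟎 ∷ [] , 𝟏 ∷ 𝟐 ∷ 𝟎 ∷ 𝟐 ∷ [] , refl , (λ ()) , (λ ())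
hIter-⋐ (suc n) = ⋐-ĥ (hIter-⋐ n)

snoc-view : ∀ (Z : List Σ₃) → Z ≢ [] → ∃₂ λ I x → Z ≡ I ∷ʳ x
snoc-view Z Z≢[] with initLast Z
... | []      = ⊥-elim (Z≢[] refl)
... | I ∷ʳ′ x = I , x , refl

cons-view : ∀ (Z : List Σ₃) → Z ≢ [] → ∃₂ λ x J → Z ≡ x ∷ J
cons-view []      Z≢[] = ⊥-elim (Z≢[] refl)
cons-view (x ∷ J) _    = x , J , refl

⊑-⋐-context : ∀ {w X Y} → w ⊑ X → X ⋐ Y → ∃₂ λ x x′ → x ∷ w ∷ʳ x′ ⊑ Y
⊑-⋐-context {w} (A , B , refl) (L , R , refl , L≢[] , R≢[])
  with snoc-view (L ++ A) (λ e → L≢[] (++-conicalˡ L A e)) | cons-view (B ++ R) (λ e → R≢[] (++-conicalʳ B R e))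
... | I , x , eqL | x′ , J , eqR = x , x′ , bracket-⊑ I J (begin
  L ++ (A ++ w ++ B) ++ R      ≡⟨ cong (L ++_) (trans (++-assoc A (w ++ B) R) (cong (A ++_) (++-assoc w B R))) ⟩
  L ++ A ++ w ++ B ++ R        ≡⟨ ++-assoc L A (w ++ B ++ R) ⟨
  (L ++ A) ++ w ++ B ++ R      ≡⟨ cong₂ (λ P S → P ++ w ++ S) eqL eqR ⟩
  (I ∷ʳ x) ++ w ++ (x′ ∷ J)    ∎)

factor-⊑ : ∀ {u w} → u ⊑ w → IsFactor w → IsFactor u
factor-⊑ u⊑w (n , w⊑) = n , ⊑-trans u⊑w w⊑

factor-infix : ∀ P w Q → IsFactor (P ++ w ++ Q) → IsFactor w
factor-infix P w Q = factor-⊑ (⊑-inner P w Q)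

factor-ĥ : ∀ {w} → IsFactor w → IsFactor (ĥ w)
factor-ĥ (n , w⊑) = suc n , ⊑-ĥ w⊑

factor-reverse : ∀ {w} → IsFactor w → IsFactor (reverse w)
factor-reverse {w} (n , w⊑) = n , subst (reverse w ⊑_) (hIter-palindrome n) (⊑-reverse w⊑)

factor-preimage : ∀ {w} → IsFactor w → ∃ λ X → IsFactor X × w ⊑ ĥ X
factor-preimage (n , w⊑) = hIter n , (n , ⊑-refl (hIter n)) , ⊑-trans w⊑ (≼⇒⊑ (hIter-≼-suc n))

factor-context : ∀ {w} → IsFactor w → ∃₂ λ x x′ → IsFactor (x ∷ w ∷ʳ x′)
factor-context (n , w⊑) with ⊑-⋐-context w⊑ (hIter-⋐ n)
... | x , x′ , ⊑Y = x , x′ , suc (suc n) , ⊑Y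

-- Desubstitution

-- the first and last letter of h a
edge : Σ₃ → Σ₃
edge 𝟎 = 𝟏
edge 𝟏 = 𝟐
edge 𝟐 = 𝟐

Not𝟎 : Maybe Σ₃ → Set
Not𝟎 (just 𝟎) = ⊥
Not𝟎 _        = ⊤

edge-𝟏 : ∀ {z} → edge z ≡ 𝟏 → z ≡ 𝟎
edge-𝟏 {𝟎} _ = refl

edge-𝟐 : ∀ {z} → edge z ≡ 𝟐 → Not𝟎 (just z)
edge-𝟐 {𝟏} _ = tt
edge-𝟐 {𝟐} _ = tt

-- a cut of an image ĥ X between the letters p and s can only fail to be a cut of X
-- when it falls inside an occurrence of h 𝟐 = 202
Joinable : Maybe Σ₃ → Maybe Σ₃ → Set
Joinable (just 𝟐) (just 𝟎) = ⊥
Joinable (just 𝟎) (just 𝟐) = ⊥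
Joinable _        _        = ⊤

joinable : ∀ {p s} → Not𝟎 p → Not𝟎 s → Joinable p s
joinable {nothing}          _ _ = tt
joinable {just 𝟏}           _ _ = tt
joinable {just 𝟐} {nothing} _ _ = tt
joinable {just 𝟐} {just 𝟏}  _ _ = tt
joinable {just 𝟐} {just 𝟐}  _ _ = tt

Separated : List Σ₃ → List Σ₃ → Set
Separated P S = Joinable (last P) (head S)

separated-∷ : ∀ {p} P {S} → Separated (p ∷ P) S → Separated P S
separated-∷ []      _   = tt
separated-∷ (_ ∷ _) sep = sep

Split : List Σ₃ → List Σ₃ → List Σ₃ → Set
Split X P S = ∃₂ λ X₁ X₂ → X ≡ X₁ ++ X₂ × ĥ X₁ ≡ P × ĥ X₂ ≡ S

split-∷ : ∀ x {X P S} → Split X P S → Split (x ∷ X) (h x ++ P) S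
split-∷ x (X₁ , X₂ , refl , refl , e₂) = x ∷ X₁ , X₂ , refl , refl , e₂

ĥ-split : ∀ X P S → ĥ X ≡ P ++ S → Separated P S → Split X P S
ĥ-split X       []              S eq   _   = [] , X , refl , refl , eq
ĥ-split (𝟎 ∷ X) (p ∷ P)         S eq   sep with ∷-injective eq
... | refl , eq′ = split-∷ 𝟎 (ĥ-split X P S eq′ (separated-∷ P sep))
ĥ-split (𝟏 ∷ X) (p ∷ P)         S eq   sep with ∷-injective eq
... | refl , eq′ = split-∷ 𝟏 (ĥ-split X P S eq′ (separated-∷ P sep))
ĥ-split (𝟐 ∷ X) (p ∷ [])        S refl ()
ĥ-split (𝟐 ∷ X) (p ∷ q ∷ [])    S refl ()
ĥ-split (𝟐 ∷ X) (p ∷ q ∷ r ∷ P) S eq   sep with ∷-injective eq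
... | refl , eq₁ with ∷-injective eq₁
... | refl , eq₂ with ∷-injective eq₂
... | refl , eq₃ = split-∷ 𝟐 (ĥ-split X P S eq₃ (separated-∷ P sep))

ĥ-split₃ : ∀ X P W S → ĥ X ≡ P ++ W ++ S → Separated P (W ++ S) → Separated W S →
           ∃ λ X₁ → ∃₂ λ V X₂ → X ≡ X₁ ++ V ++ X₂ × ĥ X₁ ≡ P × ĥ V ≡ W × ĥ X₂ ≡ S
ĥ-split₃ X P W S eq sep₁ sep₂ with ĥ-split X P (W ++ S) eq sep₁
... | X₁ , Y , refl , e₁ , eY with ĥ-split Y W S eY sep₂
... | V , X₂ , refl , eV , e₂ = X₁ , V , X₂ , refl , e₁ , eV , e₂

ĥ-head≢𝟎 : ∀ X {S} → ĥ X ≢ 𝟎 ∷ S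
ĥ-head≢𝟎 (𝟎 ∷ _) ()
ĥ-head≢𝟎 (𝟏 ∷ _) ()
ĥ-head≢𝟎 (𝟐 ∷ _) ()

preimage-head : ∀ X {x S} → ĥ X ≡ x ∷ S → ∃₂ λ z X′ → X ≡ z ∷ X′ × edge z ≡ x
preimage-head (𝟎 ∷ X) refl = 𝟎 , X , refl , refl
preimage-head (𝟏 ∷ X) refl = 𝟏 , X , refl , refl
preimage-head (𝟐 ∷ X) refl = 𝟐 , X , refl , refl

preimage-𝟐𝟎 : ∀ X {S} → ĥ X ≡ 𝟐 ∷ 𝟎 ∷ S → ∃ λ X′ → X ≡ 𝟐 ∷ X′
preimage-𝟐𝟎 (𝟏 ∷ X) eq   = ⊥-elim (ĥ-head≢𝟎 X (∷-injectiveʳ eq))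
preimage-𝟐𝟎 (𝟐 ∷ X) refl = X , refl

preimage-[𝟐] : ∀ X → ĥ X ≡ 𝟐 ∷ [] → X ≡ 𝟏 ∷ []
preimage-[𝟐] (𝟏 ∷ X) eq = cong (𝟏 ∷_) (ĥ-[] (∷-injectiveʳ eq))

reverse-∷ʳ : ∀ (P : List Σ₃) x → reverse (P ∷ʳ x) ≡ x ∷ reverse P
reverse-∷ʳ P x = reverse-++ P (x ∷ [])

ĥ-reverse-∷ʳ : ∀ X {P x} → ĥ X ≡ P ∷ʳ x → ĥ (reverse X) ≡ x ∷ reverse P
ĥ-reverse-∷ʳ X {P} {x} eq = trans (ĥ-reverse X) (trans (cong reverse eq) (reverse-∷ʳ P x))

reverse≡∷ : ∀ (X : List Σ₃) {z Y} → reverse X ≡ z ∷ Y → X ≡ reverse Y ∷ʳ z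
reverse≡∷ X {z} {Y} eq = trans (sym (reverse-involutive X)) (trans (cong reverse eq) (unfold-reverse z Y))

preimage-last : ∀ X {P x} → ĥ X ≡ P ∷ʳ x → ∃₂ λ X′ z → X ≡ X′ ∷ʳ z × edge z ≡ x
preimage-last X eq with preimage-head (reverse X) (ĥ-reverse-∷ʳ X eq)
... | z , Y , e , ez = reverse Y , z , reverse≡∷ X e , ez

preimage-𝟎𝟐 : ∀ X {P} → ĥ X ≡ (P ∷ʳ 𝟎) ∷ʳ 𝟐 → ∃ λ X′ → X ≡ X′ ∷ʳ 𝟐
preimage-𝟎𝟐 X {P} eq
  with preimage-𝟐𝟎 (reverse X) (trans (ĥ-reverse-∷ʳ X eq) (cong (𝟐 ∷_) (reverse-∷ʳ P 𝟎)))
... | Y , e = reverse Y , reverse≡∷ X e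

ĥ-first-letter : ∀ x x′ {V V′} → ĥ (x ∷ V) ≡ ĥ (x′ ∷ V′) → x ≡ x′
ĥ-first-letter 𝟎 𝟎 _ = refl
ĥ-first-letter 𝟏 𝟏 _ = refl
ĥ-first-letter 𝟐 𝟐 _ = refl
ĥ-first-letter 𝟏 𝟐 {V} eq = ⊥-elim (ĥ-head≢𝟎 V (∷-injectiveʳ eq))
ĥ-first-letter 𝟐 𝟏 {V′ = V′} eq = ⊥-elim (ĥ-head≢𝟎 V′ (∷-injectiveʳ (sym eq)))

ĥ-injective : ∀ {V V′} → ĥ V ≡ ĥ V′ → V ≡ V′
ĥ-injective {[]}    eq = sym (ĥ-[] (sym eq))
ĥ-injective {x ∷ V} {[]} eq with () ← ĥ-[] {x ∷ V} eq
ĥ-injective {x ∷ V} {x′ ∷ V′} eq with refl ← ĥ-first-letter x x′ {V} {V′} eq =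
  cong (x ∷_) (ĥ-injective {V} {V′} (++-cancelˡ (h x) (ĥ V) (ĥ V′) eq))

-- 0 occurs in an image only as the middle letter of h 𝟐 = 202
after-𝟎 : ∀ X A {S} → ĥ X ≡ A ++ 𝟎 ∷ S → ∃ λ X′ → S ≡ 𝟐 ∷ ĥ X′
after-𝟎 (𝟎 ∷ X) (_ ∷ A)         eq   = after-𝟎 X A (∷-injectiveʳ eq)
after-𝟎 (𝟏 ∷ X) (_ ∷ A)         eq   = after-𝟎 X A (∷-injectiveʳ eq)
after-𝟎 (𝟐 ∷ X) (_ ∷ [])        refl = X , refl
after-𝟎 (𝟐 ∷ X) (_ ∷ _ ∷ _ ∷ A) eq   = after-𝟎 X A (∷-injectiveʳ (∷-injectiveʳ (∷-injectiveʳ eq)))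
after-𝟎 [] [] ()
after-𝟎 [] (_ ∷ _) ()
after-𝟎 (𝟎 ∷ _) [] ()
after-𝟎 (𝟏 ∷ _) [] ()
after-𝟎 (𝟐 ∷ _) [] ()
after-𝟎 (𝟐 ∷ _) (_ ∷ _ ∷ []) ()

last-∷ʳ : ∀ (A : List Σ₃) x → last (A ∷ʳ x) ≡ just x
last-∷ʳ []          x = refl
last-∷ʳ (a ∷ [])    x = refl
last-∷ʳ (a ∷ b ∷ A) x = last-∷ʳ (b ∷ A) x

Not𝟎-last-∷ʳ : ∀ A {x} → Not𝟎 (just x) → Not𝟎 (last (A ∷ʳ x))
Not𝟎-last-∷ʳ A {x} nx = subst Not𝟎 (sym (last-∷ʳ A x)) nx

Not𝟎-head-++ : ∀ W {x B} → Not𝟎 (head W) → Not𝟎 (just x) → Not𝟎 (head (W ++ x ∷ B))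
Not𝟎-head-++ []      _  nx = nx
Not𝟎-head-++ (_ ∷ _) nw _  = nw

separated-∷ʳ : ∀ A {x S} → Not𝟎 (just x) → Not𝟎 (head S) → Separated (A ∷ʳ x) S
separated-∷ʳ A {x} nx nS = subst (λ l → Joinable l _) (sym (last-∷ʳ A x)) (joinable nx nS)

desubstitute : ∀ {x W x′} → Not𝟎 (just x) → Not𝟎 (head W) → Not𝟎 (last W) → Not𝟎 (just x′) →
               IsFactor (x ∷ W ∷ʳ x′) →
               ∃ λ V → ĥ V ≡ W × ∃₂ λ z z′ → IsFactor (z ∷ V ∷ʳ z′) × edge z ≡ x × edge z′ ≡ x′
desubstitute {x} {W} {x′} nx hW lW nx′ fac with factor-preimage fac
... | X , facX , A , B , eq
  with ĥ-split₃ X (A ∷ʳ x) W (x′ ∷ B) (trans eq (sym (bracket-assoc A x W x′ B)))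
                (separated-∷ʳ A nx (Not𝟎-head-++ W hW nx′)) (joinable lW nx′)
... | X₁ , V , X₂ , refl , e₁ , eV , e₂ with preimage-last X₁ e₁ | preimage-head X₂ e₂
... | X₁′ , z , refl , ez | z′ , X₂′ , refl , ez′ =
  V , eV , z , z′ , factor-⊑ (bracket-⊑ X₁′ X₂′ refl) facX , ez , ez′

desubstitute-𝟎𝟐M𝟐𝟎 : ∀ {M} → Not𝟎 (head M) → Not𝟎 (last M) → IsFactor (𝟎 ∷ (𝟐 ∷ M ∷ʳ 𝟐) ∷ʳ 𝟎) →
                     ∃ λ V → ĥ V ≡ M × IsFactor (𝟐 ∷ V ∷ʳ 𝟐)
desubstitute-𝟎𝟐M𝟐𝟎 {M} hM lM fac with factor-preimage fac
... | X , facX , A , B , eq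
  with ĥ-split₃ X ((A ∷ʳ 𝟎) ∷ʳ 𝟐) M (𝟐 ∷ 𝟎 ∷ B)
                (trans eq (trans (sym (bracket-assoc A 𝟎 (𝟐 ∷ M ∷ʳ 𝟐) 𝟎 B)) (sym (bracket-assoc (A ∷ʳ 𝟎) 𝟐 M 𝟐 (𝟎 ∷ B)))))
                (separated-∷ʳ (A ∷ʳ 𝟎) tt (Not𝟎-head-++ M hM tt)) (joinable lM tt)
... | X₁ , V , X₂ , refl , e₁ , eV , e₂ with preimage-𝟎𝟐 X₁ e₁ | preimage-𝟐𝟎 X₂ e₂
... | X₁′ , refl | X₂′ , refl = V , eV , factor-⊑ (bracket-⊑ X₁′ X₂′ refl) facX

preimage-𝟐M𝟐 : ∀ X {M} → Not𝟎 (head M) → Not𝟎 (last M) → ĥ X ≡ 𝟐 ∷ M ∷ʳ 𝟐 → ∃ λ V → X ≡ 𝟏 ∷ V ∷ʳ 𝟏 × ĥ V ≡ M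
preimage-𝟐M𝟐 X {M} hM lM eq with ĥ-split₃ X (𝟐 ∷ []) M (𝟐 ∷ []) eq (joinable tt (Not𝟎-head-++ M hM tt)) (joinable lM tt)
... | X₁ , V , X₂ , refl , e₁ , eV , e₂ with refl ← preimage-[𝟐] X₁ e₁ | refl ← preimage-[𝟐] X₂ e₂ = V , refl , eV

desubstitute-𝟐M𝟐 : ∀ {x M x′} → Not𝟎 (just x) → Not𝟎 (head M) → Not𝟎 (last M) → Not𝟎 (just x′) →
                   IsFactor (x ∷ (𝟐 ∷ M ∷ʳ 𝟐) ∷ʳ x′) →
                   ∃ λ V → ĥ V ≡ M × ∃₂ λ z z′ → IsFactor (z ∷ (𝟏 ∷ V ∷ʳ 𝟏) ∷ʳ z′) × edge z ≡ x × edge z′ ≡ x′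
desubstitute-𝟐M𝟐 {M = M} nx hM lM nx′ fac with desubstitute nx tt (Not𝟎-last-∷ʳ (𝟐 ∷ M) tt) nx′ fac
... | V′ , eV′ , z , z′ , facV′ , ez , ez′ with preimage-𝟐M𝟐 V′ hM lM eV′
... | V , refl , eV = V , eV , z , z′ , facV′ , ez , ez′

𝟎-followed-by-𝟐 : ∀ {x R} → IsFactor (𝟎 ∷ x ∷ R) → x ≡ 𝟐
𝟎-followed-by-𝟐 fac with factor-preimage fac
... | X , _ , A , B , eq with after-𝟎 X A eq
... | _ , e = ∷-injectiveˡ e

𝟎-preceded-by-𝟐 : ∀ {x R} → IsFactor (x ∷ 𝟎 ∷ R) → x ≡ 𝟐
𝟎-preceded-by-𝟐 {x} {R} fac = 𝟎-followed-by-𝟐 (factor-reverse (factor-infix [] (x ∷ 𝟎 ∷ []) R fac))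

¬𝟎𝟐𝟎 : ∀ {R} → ¬ IsFactor (𝟎 ∷ 𝟐 ∷ 𝟎 ∷ R)
¬𝟎𝟐𝟎 fac with factor-preimage fac
... | X , _ , A , B , eq with after-𝟎 X A eq
... | X′ , e = ĥ-head≢𝟎 X′ (∷-injectiveʳ (sym e))

¬𝟏𝟏 : ∀ {R} → ¬ IsFactor (𝟏 ∷ 𝟏 ∷ R)
¬𝟏𝟏 {R} fac with desubstitute {𝟏} {[]} {𝟏} tt tt tt tt (factor-infix [] (𝟏 ∷ 𝟏 ∷ []) R fac)
... | V , eV , z , z′ , facV , ez , ez′
  with refl ← ĥ-[] {V} eV | refl ← edge-𝟏 ez | refl ← edge-𝟏 ez′
  with () ← 𝟎-followed-by-𝟐 facV

¬𝟏𝟐𝟏 : ¬ IsFactor (𝟏 ∷ 𝟐 ∷ 𝟏 ∷ [])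
¬𝟏𝟐𝟏 fac with desubstitute {𝟏} {𝟐 ∷ []} {𝟏} tt tt tt tt fac
... | V , eV , z , z′ , facV , ez , ez′
  with refl ← preimage-[𝟐] V eV | refl ← edge-𝟏 ez | refl ← edge-𝟏 ez′
  with () ← 𝟎-followed-by-𝟐 facV

𝟐-before-𝟎𝟏 : ∀ {a c R} → c ≢ 𝟐 → IsFactor (a ∷ c ∷ R) → a ≡ 𝟐
𝟐-before-𝟎𝟏 {c = 𝟎} _ fac = 𝟎-preceded-by-𝟐 fac
𝟐-before-𝟎𝟏 {𝟎} {𝟏} _ fac with () ← 𝟎-followed-by-𝟐 fac
𝟐-before-𝟎𝟏 {𝟏} {𝟏} _ fac = ⊥-elim (¬𝟏𝟏 fac)
𝟐-before-𝟎𝟏 {𝟐} {𝟏} _ _   = refl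
𝟐-before-𝟎𝟏 {c = 𝟐} c≢𝟐 _ = ⊥-elim (c≢𝟐 refl)

square-𝟐 : ∀ {a R} → IsFactor (a ∷ a ∷ R) → a ≡ 𝟐
square-𝟐 {𝟎} fac = 𝟐-before-𝟎𝟏 (λ ()) fac
square-𝟐 {𝟏} fac = 𝟐-before-𝟎𝟏 (λ ()) fac
square-𝟐 {𝟐} _   = refl

factor-𝟐𝟐 : IsFactor (𝟐 ∷ 𝟐 ∷ [])
factor-𝟐𝟐 = 3 , 𝟐 ∷ 𝟎 ∷ 𝟐 ∷ 𝟏 ∷ 𝟐 ∷ 𝟎 ∷ [] , 𝟐 ∷ 𝟎 ∷ 𝟐 ∷ 𝟏 ∷ 𝟐 ∷ 𝟎 ∷ 𝟐 ∷ [] , refl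

factor-𝟐c𝟐 : ∀ c → IsFactor (𝟐 ∷ c ∷ 𝟐 ∷ [])
factor-𝟐c𝟐 𝟎 = 1 , [] , [] , refl
factor-𝟐c𝟐 𝟏 = 2 , 𝟐 ∷ 𝟎 ∷ [] , 𝟎 ∷ 𝟐 ∷ [] , refl
factor-𝟐c𝟐 𝟐 = 3 , 𝟐 ∷ 𝟎 ∷ 𝟐 ∷ 𝟏 ∷ 𝟐 ∷ 𝟎 ∷ [] , 𝟎 ∷ 𝟐 ∷ 𝟏 ∷ 𝟐 ∷ 𝟎 ∷ 𝟐 ∷ [] , refl

reverse-bracket : ∀ a (W : List Σ₃) a′ → reverse (a ∷ W ∷ʳ a′) ≡ a′ ∷ reverse W ∷ʳ a
reverse-bracket a W a′ = trans (unfold-reverse a (W ∷ʳ a′)) (cong (_∷ʳ a) (reverse-∷ʳ W a′))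

data Palindromic : List Σ₃ → Set where
  empty   : Palindromic []
  single  : ∀ c → Palindromic (c ∷ [])
  bracket : ∀ c {M} → Palindrome M → Palindromic (c ∷ M ∷ʳ c)

palindromic : ∀ {W} → Palindrome W → Palindromic W
palindromic {[]}    _   = empty
palindromic {c ∷ K} pal with initLast K
... | []      = single c
... | I ∷ʳ′ l with refl , e ← ∷-injective (trans (sym (reverse-bracket c I l)) pal) =
  bracket c (∷ʳ-injectiveˡ (reverse I) I e)

bracket-palindrome : ∀ {M} c → Palindrome M → Palindrome (c ∷ M ∷ʳ c)
bracket-palindrome {M} c pal = trans (reverse-bracket c M c) (cong (λ Z → c ∷ Z ∷ʳ c) pal)

Not𝟎-last-palindrome : ∀ {W} → Palindrome W → Not𝟎 (head W) → Not𝟎 (last W)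
Not𝟎-last-palindrome pal with palindromic pal
... | empty           = λ _ → tt
... | single c        = λ n → n
... | bracket c {M} _ = Not𝟎-last-∷ʳ (c ∷ M)

preimage-palindrome : ∀ {V W} → ĥ V ≡ W → Palindrome W → Palindrome V
preimage-palindrome {V} refl pal = ĥ-injective {reverse V} {V} (trans (ĥ-reverse V) pal)

factor-mirror : ∀ {x W x′} → Palindrome W → IsFactor (x ∷ W ∷ʳ x′) → IsFactor (x′ ∷ W ∷ʳ x)
factor-mirror {x} {W} {x′} pal fac =
  subst IsFactor (trans (reverse-bracket x W x′) (cong (λ Z → x′ ∷ Z ∷ʳ x) pal)) (factor-reverse fac)

factor-inner : ∀ {z} V {z′} → IsFactor (z ∷ V ∷ʳ z′) → IsFactor V
factor-inner {z} V {z′} = factor-infix (z ∷ []) V (z′ ∷ [])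

-- 𝟏 ∷ V ∷ʳ 𝟏 need not be shorter than 𝟐 ∷ ĥ V ∷ʳ 𝟐, but it is lighter
letter-weight : Σ₃ → ℕ
letter-weight 𝟎 = 1
letter-weight 𝟏 = 2
letter-weight 𝟐 = 3

weight : List Σ₃ → ℕ
weight []      = 0
weight (x ∷ X) = letter-weight x + weight X

weight-++ : ∀ X Y → weight (X ++ Y) ≡ weight X + weight Y
weight-++ []      Y = refl
weight-++ (x ∷ X) Y = trans (cong (letter-weight x +_) (weight-++ X Y)) (sym (+-assoc (letter-weight x) (weight X) (weight Y)))

weight-bracket : ∀ a V → weight (a ∷ V ∷ʳ a) ≡ letter-weight a + (weight V + letter-weight a)
weight-bracket a V = cong (letter-weight a +_) (trans (weight-++ V (a ∷ [])) (cong (weight V +_) (+-identityʳ (letter-weight a))))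

weight-h : ∀ x → letter-weight x < weight (h x)
weight-h 𝟎 = s≤s (s≤s z≤n)
weight-h 𝟏 = s≤s (s≤s (s≤s z≤n))
weight-h 𝟐 = s≤s (s≤s (s≤s (s≤s z≤n)))

weight-ĥ : ∀ X → weight X ≤ weight (ĥ X)
weight-ĥ []      = z≤n
weight-ĥ (x ∷ X) = subst (weight (x ∷ X) ≤_) (sym (weight-++ (h x) (ĥ X))) (+-mono-≤ (<⇒≤ (weight-h x)) (weight-ĥ X))

weight-ĥ-∷ : ∀ x X → weight (x ∷ X) < weight (ĥ (x ∷ X))
weight-ĥ-∷ x X = subst (weight (x ∷ X) <_) (sym (weight-++ (h x) (ĥ X))) (+-mono-<-≤ (weight-h x) (weight-ĥ X))

infix 4 _⊏_
_⊏_ : List Σ₃ → List Σ₃ → Set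
V ⊏ W = weight V < weight W

⊏-wellFounded : WellFounded _⊏_
⊏-wellFounded = On.wellFounded weight <-wellFounded

preimage-⊏ : ∀ {V c K} → ĥ V ≡ c ∷ K → V ⊏ c ∷ K
preimage-⊏ {x ∷ V} eq = subst (λ W → x ∷ V ⊏ W) eq (weight-ĥ-∷ x V)

⊏-bracket : ∀ {V U} c → weight V ≤ weight U → V ⊏ c ∷ U ∷ʳ c
⊏-bracket {V} {U} c V≤U = subst (weight V <_) (sym (weight-bracket c U))
  (+-mono-≤ (letter-weight-positive c) (≤-trans V≤U (m≤m+n (weight U) (letter-weight c))))
  where
  letter-weight-positive : ∀ c → 1 ≤ letter-weight c
  letter-weight-positive 𝟎 = s≤s z≤n
  letter-weight-positive 𝟏 = s≤s z≤n
  letter-weight-positive 𝟐 = s≤s z≤n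

bracket-⊏ : ∀ {a c V U} → letter-weight a < letter-weight c → weight V ≤ weight U → a ∷ V ∷ʳ a ⊏ c ∷ U ∷ʳ c
bracket-⊏ {a} {c} {V} {U} a<c V≤U = subst₂ _<_ (sym (weight-bracket a V)) (sym (weight-bracket c U))
  (+-mono-<-≤ a<c (+-mono-≤ V≤U (<⇒≤ a<c)))

-- Palindromic extensions

ĥ-extension : ∀ a {V} → IsFactor (a ∷ V ∷ʳ a) → IsFactor (edge a ∷ ĥ V ∷ʳ edge a)
ĥ-extension 𝟎 {V} fac = subst IsFactor (ĥ-bracket 𝟎 V 𝟎) (factor-ĥ fac)
ĥ-extension 𝟏 {V} fac = subst IsFactor (ĥ-bracket 𝟏 V 𝟏) (factor-ĥ fac)
ĥ-extension 𝟐 {V} fac = factor-⊑ (bracket-⊑ (𝟐 ∷ 𝟎 ∷ []) (𝟎 ∷ 𝟐 ∷ []) (ĥ-bracket 𝟐 V 𝟐)) (factor-ĥ fac)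

ĥ-𝟐-extension : ∀ {V} → IsFactor (𝟐 ∷ V ∷ʳ 𝟐) → IsFactor (𝟎 ∷ (𝟐 ∷ ĥ V ∷ʳ 𝟐) ∷ʳ 𝟎)
ĥ-𝟐-extension {V} fac = factor-⊑ (bracket-⊑ (𝟐 ∷ []) {𝟎} {𝟐 ∷ ĥ V ∷ʳ 𝟐} (𝟐 ∷ [])
  (trans (ĥ-bracket 𝟐 V 𝟐) (cong (λ Z → 𝟐 ∷ 𝟎 ∷ 𝟐 ∷ Z) (sym (++-assoc (ĥ V) (𝟐 ∷ []) (𝟎 ∷ 𝟐 ∷ []))))))
  (factor-ĥ fac)

ExtendsBy : List Σ₃ → Σ₃ → Set
ExtendsBy W a = IsFactor (a ∷ W ∷ʳ a)

UniqueExtension : List Σ₃ → Set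
UniqueExtension W = ∀ {a b} → ExtendsBy W a → ExtendsBy W b → a ≡ b

ZeroExclusive : List Σ₃ → Set
ZeroExclusive W = ∀ {x x′} → Not𝟎 (just x) → Not𝟎 (just x′) → ExtendsBy W 𝟎 → ¬ IsFactor (x ∷ W ∷ʳ x′)

record Extensions (W : List Σ₃) : Set where
  field
    extension      : ∃ (ExtendsBy W)
    unique         : UniqueExtension W
    zero-exclusive : ZeroExclusive W
open Extensions

unique-extension : ∀ {W} → ZeroExclusive W → (ExtendsBy W 𝟏 → ¬ ExtendsBy W 𝟐) → UniqueExtension W
unique-extension excl ¬𝟏𝟐 {𝟎} {𝟎} _ _ = refl
unique-extension excl ¬𝟏𝟐 {𝟏} {𝟏} _ _ = refl
unique-extension excl ¬𝟏𝟐 {𝟐} {𝟐} _ _ = refl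
unique-extension excl ¬𝟏𝟐 {𝟎} {𝟏} f g = ⊥-elim (excl tt tt f g)
unique-extension excl ¬𝟏𝟐 {𝟎} {𝟐} f g = ⊥-elim (excl tt tt f g)
unique-extension excl ¬𝟏𝟐 {𝟏} {𝟎} f g = ⊥-elim (excl tt tt g f)
unique-extension excl ¬𝟏𝟐 {𝟐} {𝟎} f g = ⊥-elim (excl tt tt g f)
unique-extension excl ¬𝟏𝟐 {𝟏} {𝟐} f g = ⊥-elim (¬𝟏𝟐 f g)
unique-extension excl ¬𝟏𝟐 {𝟐} {𝟏} f g = ⊥-elim (¬𝟏𝟐 g f)

ExtensionsBelow : List Σ₃ → Set
ExtensionsBelow W = ∀ {V} → V ⊏ W → Palindrome V → IsFactor V → Extensions V

extensions-[] : Extensions []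
extensions-[] = record
  { extension      = 𝟐 , factor-𝟐𝟐
  ; unique         = unique-extension {[]} excl (λ f _ → ¬𝟏𝟏 f)
  ; zero-exclusive = excl
  }
  where
  excl : ZeroExclusive []
  excl _ _ f _ with () ← square-𝟐 f

extensions-[𝟐] : Extensions (𝟐 ∷ [])
extensions-[𝟐] = record
  { extension      = 𝟐 , factor-𝟐c𝟐 𝟐
  ; unique         = unique-extension {𝟐 ∷ []} excl (λ f _ → ¬𝟏𝟐𝟏 f)
  ; zero-exclusive = excl
  }
  where
  excl : ZeroExclusive (𝟐 ∷ [])
  excl _ _ f _ = ¬𝟎𝟐𝟎 f

non𝟐-extends-by-𝟐 : ∀ {c W} → c ≢ 𝟐 → Palindrome (c ∷ W) → IsFactor (c ∷ W) → ExtendsBy (c ∷ W) 𝟐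
non𝟐-extends-by-𝟐 c≢𝟐 pal fac with factor-context fac
... | x , x′ , f with refl ← 𝟐-before-𝟎𝟏 c≢𝟐 f | refl ← 𝟐-before-𝟎𝟏 c≢𝟐 (factor-mirror pal f) = f

extensions-non𝟐 : ∀ {c W} → c ≢ 𝟐 → Palindrome (c ∷ W) → IsFactor (c ∷ W) → Extensions (c ∷ W)
extensions-non𝟐 {c} {W} c≢𝟐 pal fac = record
  { extension      = 𝟐 , non𝟐-extends-by-𝟐 c≢𝟐 pal fac
  ; unique         = unique-extension {c ∷ W} excl ¬𝟏𝟐
  ; zero-exclusive = excl
  }
  where
  ¬𝟏𝟐 : ExtendsBy (c ∷ W) 𝟏 → ¬ ExtendsBy (c ∷ W) 𝟐
  ¬𝟏𝟐 f _ with () ← 𝟐-before-𝟎𝟏 c≢𝟐 f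

  excl : ZeroExclusive (c ∷ W)
  excl _ _ f _ = c≢𝟐 (𝟎-followed-by-𝟐 f)

extensions-𝟐𝟎 : ∀ {K} → Palindrome (𝟐 ∷ 𝟎 ∷ K) → IsFactor (𝟐 ∷ 𝟎 ∷ K) → ExtensionsBelow (𝟐 ∷ 𝟎 ∷ K) →
                Extensions (𝟐 ∷ 𝟎 ∷ K)
extensions-𝟐𝟎 {K} pal fac ih = record
  { extension      = extension′
  ; unique         = unique-extension {𝟐 ∷ 𝟎 ∷ K} excl ¬𝟏𝟐
  ; zero-exclusive = excl
  }
  where
  W = 𝟐 ∷ 𝟎 ∷ K

  nonzero-context : ∀ {x x′} → IsFactor (x ∷ W ∷ʳ x′) → Not𝟎 (just x)
  nonzero-context {𝟎} f = ¬𝟎𝟐𝟎 f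
  nonzero-context {𝟏} _ = tt
  nonzero-context {𝟐} _ = tt

  desubstitute-W : ∀ {x x′} → Not𝟎 (just x) → Not𝟎 (just x′) → IsFactor (x ∷ W ∷ʳ x′) →
                   ∃ λ V → ĥ V ≡ W × ∃₂ λ z z′ → IsFactor (z ∷ V ∷ʳ z′) × edge z ≡ x × edge z′ ≡ x′
  desubstitute-W nx nx′ = desubstitute nx tt (Not𝟎-last-palindrome pal tt) nx′

  below : ∀ V {z z′} → ĥ V ≡ W → IsFactor (z ∷ V ∷ʳ z′) → Extensions V
  below V eV facV = ih {V} (preimage-⊏ {V} eV) (preimage-palindrome eV pal) (factor-inner V facV)

  extension′ : ∃ (ExtendsBy W)
  extension′ with factor-context fac
  ... | x , x′ , f with desubstitute-W (nonzero-context f) (nonzero-context (factor-mirror pal f)) f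
  ... | V , eV , _ , _ , facV , _ with extension (below V eV facV)
  ... | a , fa = edge a , subst (λ U → ExtendsBy U (edge a)) eV (ĥ-extension a {V} fa)

  excl : ZeroExclusive W
  excl _ _ f _ = ¬𝟎𝟐𝟎 f

  ¬𝟏𝟐 : ExtendsBy W 𝟏 → ¬ ExtendsBy W 𝟐
  ¬𝟏𝟐 f₁ f₂ with desubstitute-W tt tt f₁ | desubstitute-W tt tt f₂
  ... | V , eV , _ , _ , g₁ , e₁ , e₁′ | V₂ , eV₂ , _ , _ , g₂ , e₂ , e₂′
    with refl ← ĥ-injective {V₂} {V} (trans eV₂ (sym eV)) | refl ← edge-𝟏 e₁ | refl ← edge-𝟏 e₁′ =
    zero-exclusive (below V eV g₁) (edge-𝟐 e₂) (edge-𝟐 e₂′) g₁ g₂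

extensions-𝟐M𝟐 : ∀ {M} → Palindrome M → Not𝟎 (head M) → IsFactor (𝟐 ∷ M ∷ʳ 𝟐) → ExtensionsBelow (𝟐 ∷ M ∷ʳ 𝟐) →
                 Extensions (𝟐 ∷ M ∷ʳ 𝟐)
extensions-𝟐M𝟐 palM hM fac ih with desubstitute tt hM (Not𝟎-last-palindrome palM hM) tt fac
... | V , refl , _ , _ , facV , ez , ez′ = record
  { extension      = extension′
  ; unique         = unique-extension {𝟐 ∷ ĥ V ∷ʳ 𝟐} excl ¬𝟏𝟐
  ; zero-exclusive = excl
  }
  where
  W = 𝟐 ∷ ĥ V ∷ʳ 𝟐
  lM = Not𝟎-last-palindrome palM hM
  palV = preimage-palindrome refl palM

  V-extensions : Extensions V
  V-extensions = ih {V} (⊏-bracket {V} {ĥ V} 𝟐 (weight-ĥ V)) palV (factor-inner V facV)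

  𝟏V𝟏-extensions : IsFactor (𝟏 ∷ V ∷ʳ 𝟏) → Extensions (𝟏 ∷ V ∷ʳ 𝟏)
  𝟏V𝟏-extensions = ih {𝟏 ∷ V ∷ʳ 𝟏} (bracket-⊏ {𝟏} {𝟐} {V} {ĥ V} (s≤s (s≤s (s≤s z≤n))) (weight-ĥ V))
                      (bracket-palindrome 𝟏 palV)

  via-𝟎 : ExtendsBy W 𝟎 → ExtendsBy V 𝟐
  via-𝟎 f with desubstitute-𝟎𝟐M𝟐𝟎 hM lM f
  ... | V₀ , e₀ , f₀ with refl ← ĥ-injective {V₀} {V} e₀ = f₀

  via-nonzero : ∀ {x x′} → Not𝟎 (just x) → Not𝟎 (just x′) → IsFactor (x ∷ W ∷ʳ x′) →
                ∃₂ λ u u′ → IsFactor (u ∷ (𝟏 ∷ V ∷ʳ 𝟏) ∷ʳ u′) × edge u ≡ x × edge u′ ≡ x′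
  via-nonzero nx nx′ f with desubstitute-𝟐M𝟐 nx hM lM nx′ f
  ... | V₁ , e₁ , rest with refl ← ĥ-injective {V₁} {V} e₁ = rest

  extension′ : ∃ (ExtendsBy W)
  extension′ with extension V-extensions
  ... | 𝟎 , f = ⊥-elim (zero-exclusive V-extensions (edge-𝟐 ez) (edge-𝟐 ez′) f facV)
  ... | 𝟏 , f = 𝟐 , subst (λ U → ExtendsBy U 𝟐) (ĥ-bracket 𝟏 V 𝟏)
                      (ĥ-extension 𝟐 {𝟏 ∷ V ∷ʳ 𝟏} (non𝟐-extends-by-𝟐 (λ ()) (bracket-palindrome 𝟏 palV) f))
  ... | 𝟐 , f = 𝟎 , ĥ-𝟐-extension f

  excl : ZeroExclusive W
  excl nx nx′ f₀ f with via-nonzero nx nx′ f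
  ... | _ , _ , f₁ , _ with () ← unique V-extensions (via-𝟎 f₀) (factor-inner (𝟏 ∷ V ∷ʳ 𝟏) f₁)

  ¬𝟏𝟐 : ExtendsBy W 𝟏 → ¬ ExtendsBy W 𝟐
  ¬𝟏𝟐 f₁ f₂ with via-nonzero tt tt f₁ | via-nonzero tt tt f₂
  ... | _ , _ , g₁ , e₁ , e₁′ | _ , _ , g₂ , e₂ , e₂′ with refl ← edge-𝟏 e₁ | refl ← edge-𝟏 e₁′ =
    zero-exclusive (𝟏V𝟏-extensions (factor-inner (𝟏 ∷ V ∷ʳ 𝟏) g₁)) (edge-𝟐 e₂) (edge-𝟐 e₂′) g₁ g₂

palindrome-extensions : ∀ W → Palindrome W → IsFactor W → Extensions W
palindrome-extensions = All.wfRec ⊏-wellFounded _ (λ W → Palindrome W → IsFactor W → Extensions W) step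
  where
  step : ∀ W → ExtensionsBelow W → Palindrome W → IsFactor W → Extensions W
  step W ih pal fac with palindromic pal
  ... | empty                    = extensions-[]
  ... | single 𝟎                 = extensions-non𝟐 (λ ()) pal fac
  ... | single 𝟏                 = extensions-non𝟐 (λ ()) pal fac
  ... | single 𝟐                 = extensions-[𝟐]
  ... | bracket 𝟎 _              = extensions-non𝟐 (λ ()) pal fac
  ... | bracket 𝟏 _              = extensions-non𝟐 (λ ()) pal fac
  ... | bracket 𝟐 {𝟎 ∷ _} _      = extensions-𝟐𝟎 pal fac ih
  ... | bracket 𝟐 {[]} palM      = extensions-𝟐M𝟐 palM tt fac ih
  ... | bracket 𝟐 {𝟏 ∷ _} palM   = extensions-𝟐M𝟐 palM tt fac ih
  ... | bracket 𝟐 {𝟐 ∷ _} palM   = extensions-𝟐M𝟐 palM tt fac ih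

proposition27 : (w : List Σ₃) → Palindrome w → Factor w y →
                ∃! _≡_ (λ (a : Σ₃) → Factor (a ∷ (w ++ a ∷ [])) y)
proposition27 w pal fac with palindrome-extensions w pal (Factor⇒IsFactor fac)
... | props with extension props
... | a , fa = a , IsFactor⇒Factor fa , λ fb → unique props fa (Factor⇒IsFactor fb)
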